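{- Let $S,T\subseteq\mathbb{F}_2^n$ be finite. Then $S$ and $T$ are affinely equivalent if and only if there exists an $(E(S),E(T))$-isomorphism $g:S\to T$.
   Context: $S,T$ are affinely equivalent if some affine automorphism $f$ of $\mathbb{F}_2^n$ satisfies $f(S)=T$. $E(S)$ is the collection of even-size subsets of $S$ whose elements sum to $\vec 0$ (including $\varnothing$); it is a linear subspace of the $\mathbb{F}_2$-vector space $\mathcal{P}(S)$ under symmetric difference. An $(E(S),E(T))$-isomorphism is a bijection $g:S\to T$ with $\{g(X):X\in E(S)\}=E(T)$. -}

module Defs where

open import Data.Bool using (Bool; true; false; _xor_)
open import Data.Nat using (ℕ; zero; suc; _*_)
open import Data.List using (List; []; _∷_; map; _++_; filterᵇ; length; foldr)
open import Data.Vec using (Vec; []; _∷_; zipWith; replicate)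
open import Data.Product using (Σ; ∃; _×_; proj₁)
open import Function.Bundles using (_⤖_; Bijection)
open import Function.Definitions using (Bijective)
open import Relation.Binary.PropositionalEquality using (_≡_)

-- The vector space F₂ⁿ, with F₂ = Bool (false = 0, true = 1, addition = xor)
V : ℕ → Set
V n = Vec Bool n

_⊕_ : ∀ {n} → V n → V n → V n
_⊕_ = zipWith _xor_

infixl 6 _⊕_

𝟘 : ∀ {n} → V n
𝟘 = replicate _ false

_·_ : ∀ {n} → Bool → V n → V n
true  · x = x
false · x = 𝟘

allV : (n : ℕ) → List (V n)
allV zero    = [] ∷ []
allV (suc n) = map (false ∷_) (allV n) ++ map (true ∷_) (allV n)

-- subsets of F₂ⁿ, given by their characteristic function (all are finite)
Subset : ℕ → Set
Subset n = V n → Bool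

_⊆_ : ∀ {n} → Subset n → Subset n → Set
X ⊆ S = ∀ x → X x ≡ true → S x ≡ true

elems : ∀ {n} → Subset n → List (V n)
elems {n} X = filterᵇ X (allV n)

card : ∀ {n} → Subset n → ℕ
card X = length (elems X)

Σ⊕ : ∀ {n} → Subset n → V n
Σ⊕ X = foldr _⊕_ 𝟘 (elems X)

InE : ∀ {n} → Subset n → Subset n → Set
InE S X = X ⊆ S × (∃ λ k → card X ≡ 2 * k) × Σ⊕ X ≡ 𝟘

El : ∀ {n} → Subset n → Set
El {n} S = Σ (V n) (λ x → S x ≡ true)

IsImage : ∀ {n} {S T : Subset n} → (El S → El T) → Subset n → Subset n → Set
IsImage {S = S} {T = T} g X Y =
  X ⊆ S × Y ⊆ T × (∀ (s : El S) → X (proj₁ s) ≡ Y (proj₁ (g s)))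

-- g is an (E(S),E(T))-isomorphism: {g(X) : X ∈ E(S)} = E(T)
IsEIso : ∀ {n} (S T : Subset n) → El S ⤖ El T → Set
IsEIso {n} S T g =
  (∀ X → InE S X → Σ (Subset n) λ Y → InE T Y × IsImage (Bijection.to g) X Y) ×
  (∀ Y → InE T Y → Σ (Subset n) λ X → InE S X × IsImage (Bijection.to g) X Y)

IsLinear : ∀ {n} → (V n → V n) → Set
IsLinear L = (∀ x y → L (x ⊕ y) ≡ L x ⊕ L y) × (∀ c x → L (c · x) ≡ c · L x)

IsAffineAut : ∀ {n} → (V n → V n) → Set
IsAffineAut {n} f =
  Σ (V n → V n) λ L → Σ (V n) λ b →
    IsLinear L × (∀ x → f x ≡ L x ⊕ b) × Bijective _≡_ _≡_ f

AffEquiv : ∀ {n} → Subset n → Subset n → Set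
AffEquiv {n} S T =
  Σ (V n → V n) λ f → IsAffineAut f ×
    (∀ y → (T y ≡ true → ∃ λ x → S x ≡ true × f x ≡ y) ×
           ((∃ λ x → S x ≡ true × f x ≡ y) → T y ≡ true))

-- Write x̂ = (1, x) ∈ F₂ⁿ⁺¹. A finite X ⊆ F₂ⁿ has even size and zero sum exactly when
-- Σ_{x ∈ X} x̂ = 0, so E(S) is the space of linear relations among the vectors ŝ, s ∈ S.
-- An affine automorphism x ↦ L x + b acts on hatted vectors through the linear automorphism
-- (α, y) ↦ (α, L y + α b), hence maps E(S) onto E(f(S)). Conversely, an (E(S),E(T))-isomorphism
-- g says that (ŝ)ₛ and (ĝ(s))ₛ satisfy the same linear relations; then so do the differences
-- s − s₀ and g(s) − g(s₀), and two families of vectors with the same linear relations differ by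
-- a linear automorphism (by induction on the dimension, as in Gaussian elimination). Adding the
-- translation s₀ ↦ g(s₀) gives an affine automorphism extending g.

module Submission where

open import Defs
open import Algebra.Bundles using (CommutativeMonoid; CommutativeRing)
import Algebra.Properties.CommutativeSemigroup as CommutativeSemigroupProperties
open import Axiom.UniquenessOfIdentityProofs using (module Decidable⇒UIP)
open import Data.Bool using (Bool; true; false; _xor_; _∧_; not; T)
import Data.Bool as Bool
open import Data.Bool.Properties
  using ( xor-∧-commutativeRing; xor-assoc; xor-comm; xor-identityˡ; xor-identityʳ; xor-same
        ; not-involutive; ∧-distribˡ-xor; ∧-identityʳ; ∧-zeroʳ; ¬-not; T-≡ )
open import Data.Empty using (⊥-elim)
open import Data.Fin using (Fin; zero; suc)
open import Data.Fin.Properties using (any?; all?; ¬∀⟶∃¬)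
open import Data.List using (List; []; _∷_; map; _++_; filterᵇ; length; foldr; lookup)
open import Data.List.Membership.Propositional using (_∈_)
open import Data.List.Membership.Propositional.Properties
  using (∈-++⁺ˡ; ∈-++⁺ʳ; ∈-map⁺; ∈-filter⁺; ∈-filter⁻; ∈-lookup)
open import Data.List.Relation.Unary.Any using (here; index)
open import Data.List.Relation.Unary.Any.Properties using (lookup-index)
open import Data.Nat using (ℕ; zero; suc; _*_)
open import Data.Nat.Properties using (*-suc)
open import Data.Product using (Σ; ∃; _×_; _,_; proj₁; proj₂)
open import Data.Vec using ([]; _∷_; head; tail)
open import Data.Vec.Properties
  using (zipWith-assoc; zipWith-comm; zipWith-identityˡ; zipWith-identityʳ; ≡-dec)
open import Function using (_∘_; _⇔_; mk⇔; Equivalence; _⤖_; mk⤖; Bijection)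
open import Level using (0ℓ)
open import Relation.Binary.Definitions using (DecidableEquality)
open import Relation.Binary.PropositionalEquality hiding ([_])
open import Relation.Nullary using (does; yes; no)
open import Relation.Nullary.Decidable using (dec-false; does-⇔; T?)

⊕-assoc : ∀ {n} (x y z : V n) → (x ⊕ y) ⊕ z ≡ x ⊕ (y ⊕ z)
⊕-assoc = zipWith-assoc xor-assoc

⊕-comm : ∀ {n} (x y : V n) → x ⊕ y ≡ y ⊕ x
⊕-comm = zipWith-comm xor-comm

⊕-identityˡ : ∀ {n} (x : V n) → 𝟘 ⊕ x ≡ x
⊕-identityˡ = zipWith-identityˡ xor-identityˡ

⊕-identityʳ : ∀ {n} (x : V n) → x ⊕ 𝟘 ≡ x
⊕-identityʳ = zipWith-identityʳ xor-identityʳ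

⊕-self : ∀ {n} (x : V n) → x ⊕ x ≡ 𝟘
⊕-self []      = refl
⊕-self (a ∷ x) = cong₂ _∷_ (xor-same a) (⊕-self x)

⊕-commutativeMonoid : ℕ → CommutativeMonoid 0ℓ 0ℓ
⊕-commutativeMonoid n = record
  { Carrier = V n ; _≈_ = _≡_ ; _∙_ = _⊕_ ; ε = 𝟘
  ; isCommutativeMonoid = record
    { isMonoid = record
      { isSemigroup = record
        { isMagma = record { isEquivalence = isEquivalence ; ∙-cong = cong₂ _⊕_ }
        ; assoc = ⊕-assoc }
      ; identity = ⊕-identityˡ , ⊕-identityʳ }
    ; comm = ⊕-comm } }

module _ {n : ℕ} where
  open CommutativeSemigroupProperties
    (CommutativeMonoid.commutativeSemigroup (⊕-commutativeMonoid n)) public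
    using () renaming (interchange to ⊕-interchange; xy∙z≈x∙zy to ⊕-assoc-comm)

open CommutativeSemigroupProperties
  (CommutativeRing.+-commutativeSemigroup xor-∧-commutativeRing)
  using () renaming (interchange to xor-interchange)

xor-cancelʳ : ∀ x y → (x xor y) xor y ≡ x
xor-cancelʳ x y = trans (xor-assoc x y y) (trans (cong (x xor_) (xor-same y)) (xor-identityʳ x))

xor-cancelˡ : ∀ x y → x xor (x xor y) ≡ y
xor-cancelˡ x y = trans (sym (xor-assoc x x y)) (cong (_xor y) (xor-same x))

⊕-cancelʳ : ∀ {n} (x y : V n) → (x ⊕ y) ⊕ y ≡ x
⊕-cancelʳ x y = trans (⊕-assoc x y y) (trans (cong (x ⊕_) (⊕-self y)) (⊕-identityʳ x))

⊕-cancelˡ : ∀ {n} (x y : V n) → x ⊕ (y ⊕ x) ≡ y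
⊕-cancelˡ x y = trans (⊕-comm x (y ⊕ x)) (⊕-cancelʳ y x)

⊕-injectiveʳ : ∀ {n} {x y : V n} (z : V n) → x ⊕ z ≡ y ⊕ z → x ≡ y
⊕-injectiveʳ {x = x} {y} z e = trans (sym (⊕-cancelʳ x z)) (trans (cong (_⊕ z) e) (⊕-cancelʳ y z))

·-𝟘 : ∀ {n} (α : Bool) → α · 𝟘 {n} ≡ 𝟘
·-𝟘 true  = refl
·-𝟘 false = refl

·-distribʳ : ∀ {n} (α β : Bool) (x : V n) → (α xor β) · x ≡ α · x ⊕ β · x
·-distribʳ true  true  x = sym (⊕-self x)
·-distribʳ true  false x = sym (⊕-identityʳ x)
·-distribʳ false β     x = sym (⊕-identityˡ _)

·-distribˡ : ∀ {n} (α : Bool) (x y : V n) → α · (x ⊕ y) ≡ α · x ⊕ α · y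
·-distribˡ true  x y = refl
·-distribˡ false x y = sym (⊕-identityˡ 𝟘)

Additive : ∀ {n p} → (V n → V p) → Set
Additive f = ∀ x y → f (x ⊕ y) ≡ f x ⊕ f y

additive-𝟘 : ∀ {n p} {f : V n → V p} → Additive f → f 𝟘 ≡ 𝟘
additive-𝟘 {f = f} f-add = ⊕-injectiveʳ (f 𝟘) (begin
  f 𝟘 ⊕ f 𝟘  ≡⟨ sym (f-add 𝟘 𝟘) ⟩
  f (𝟘 ⊕ 𝟘)  ≡⟨ cong f (⊕-self 𝟘) ⟩
  f 𝟘        ≡⟨ sym (⊕-identityˡ (f 𝟘)) ⟩
  𝟘 ⊕ f 𝟘    ∎)
  where open ≡-Reasoning

additive-∘ : ∀ {n p q} {g : V p → V q} {f : V n → V p} → Additive g → Additive f → Additive (g ∘ f)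
additive-∘ {g = g} g-add f-add x y = trans (cong g (f-add x y)) (g-add _ _)

additive-· : ∀ {n p} {f : V n → V p} → Additive f → ∀ α x → f (α · x) ≡ α · f x
additive-· f-add true  x = refl
additive-· f-add false x = additive-𝟘 f-add

Bool-UIP : ∀ {a b : Bool} (p q : a ≡ b) → p ≡ q
Bool-UIP = Decidable⇒UIP.≡-irrelevant Bool._≟_

infix 4 _≟_
_≟_ : ∀ {n} → DecidableEquality (V n)
_≟_ = ≡-dec Bool._≟_

δ : ∀ {n} → V n → V n → Bool
δ x y = does (x ≟ y)

∑ : ∀ {A : Set} {n} → List A → (A → V n) → V n
∑ []      F = 𝟘
∑ (a ∷ l) F = F a ⊕ ∑ l F

∑-cong : ∀ {A : Set} {n} (l : List A) {F G : A → V n} → (∀ a → F a ≡ G a) → ∑ l F ≡ ∑ l G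
∑-cong []      e = refl
∑-cong (a ∷ l) e = cong₂ _⊕_ (e a) (∑-cong l e)

∑-𝟘 : ∀ {A : Set} {n} (l : List A) → ∑ {n = n} l (λ _ → 𝟘) ≡ 𝟘
∑-𝟘 []      = refl
∑-𝟘 (a ∷ l) = trans (⊕-identityˡ _) (∑-𝟘 l)

∑-⊕ : ∀ {A : Set} {n} (l : List A) (F G : A → V n) → ∑ l (λ a → F a ⊕ G a) ≡ ∑ l F ⊕ ∑ l G
∑-⊕ []      F G = sym (⊕-identityˡ 𝟘)
∑-⊕ (a ∷ l) F G = trans (cong (F a ⊕ G a ⊕_) (∑-⊕ l F G)) (⊕-interchange (F a) (G a) _ _)

∑-++ : ∀ {A : Set} {n} (l k : List A) (F : A → V n) → ∑ (l ++ k) F ≡ ∑ l F ⊕ ∑ k F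
∑-++ []      k F = sym (⊕-identityˡ _)
∑-++ (a ∷ l) k F = trans (cong (F a ⊕_) (∑-++ l k F)) (sym (⊕-assoc (F a) _ _))

∑-map : ∀ {A B : Set} {n} (g : A → B) (l : List A) (F : B → V n) → ∑ (map g l) F ≡ ∑ l (F ∘ g)
∑-map g []      F = refl
∑-map g (a ∷ l) F = cong (F (g a) ⊕_) (∑-map g l F)

additive-∑ : ∀ {A : Set} {n p} {f : V n → V p} → Additive f →
             (l : List A) (F : A → V n) → f (∑ l F) ≡ ∑ l (f ∘ F)
additive-∑ f-add []      F = additive-𝟘 f-add
additive-∑ f-add (a ∷ l) F = trans (f-add (F a) _) (cong (_ ⊕_) (additive-∑ f-add l F))

∑-swap : ∀ {A B : Set} {n} (l : List A) (k : List B) (G : A → B → V n) →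
         ∑ l (λ a → ∑ k (G a)) ≡ ∑ k (λ b → ∑ l (λ a → G a b))
∑-swap []      k G = sym (∑-𝟘 k)
∑-swap (a ∷ l) k G = trans (cong (∑ k (G a) ⊕_) (∑-swap l k G)) (sym (∑-⊕ k (G a) _))

∑-allV-suc : ∀ {n p} (F : V (suc n) → V p) →
              ∑ (allV (suc n)) F ≡ ∑ (allV n) (F ∘ (false ∷_)) ⊕ ∑ (allV n) (F ∘ (true ∷_))
∑-allV-suc {n} F = trans (∑-++ (map (false ∷_) (allV n)) _ F)
                         (cong₂ _⊕_ (∑-map (false ∷_) (allV n) F) (∑-map (true ∷_) (allV n) F))

∑-δ : ∀ {n p} (w : V n) (F : V n → V p) → ∑ (allV n) (λ v → δ w v · F v) ≡ F w
∑-δ []          F = ⊕-identityʳ _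
∑-δ {suc n} (false ∷ w) F = trans (∑-allV-suc (λ v → δ (false ∷ w) v · F v))
  (trans (cong₂ _⊕_ (∑-δ w (F ∘ (false ∷_))) (∑-𝟘 (allV n))) (⊕-identityʳ _))
∑-δ {suc n} (true ∷ w)  F = trans (∑-allV-suc (λ v → δ (true ∷ w) v · F v))
  (trans (cong₂ _⊕_ (∑-𝟘 (allV n)) (∑-δ w (F ∘ (true ∷_)))) (⊕-identityˡ _))

∑-reindex : ∀ {n p} (f g : V n → V n) → (∀ x → g (f x) ≡ x) → (∀ y → f (g y) ≡ y) →
            (F : V n → V p) → ∑ (allV n) (F ∘ f) ≡ ∑ (allV n) F
∑-reindex {n} f g g∘f f∘g F = begin
  ∑ (allV n) (F ∘ f)                                     ≡⟨ ∑-cong (allV n) (λ u → sym (∑-δ (f u) F)) ⟩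
  ∑ (allV n) (λ u → ∑ (allV n) (λ v → δ (f u) v · F v))  ≡⟨ ∑-swap (allV n) (allV n) _ ⟩
  ∑ (allV n) (λ v → ∑ (allV n) (λ u → δ (f u) v · F v))  ≡⟨ ∑-cong (allV n) (λ v → ∑-cong (allV n) (λ u →
                                                              cong (_· F v) (δ-flip u v))) ⟩
  ∑ (allV n) (λ v → ∑ (allV n) (λ u → δ (g v) u · F v))  ≡⟨ ∑-cong (allV n) (λ v → ∑-δ (g v) (λ _ → F v)) ⟩
  ∑ (allV n) F                                           ∎
  where
  open ≡-Reasoning
  δ-flip : ∀ u v → δ (f u) v ≡ δ (g v) u
  δ-flip u v = does-⇔ (mk⇔ (λ e → trans (cong g (sym e)) (g∘f u)) (λ e → trans (cong f (sym e)) (f∘g v)))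
                      (f u ≟ v) (g v ≟ u)

-- Homogenisation: E(S) as a kernel

odd : ℕ → Bool
odd zero    = false
odd (suc n) = not (odd n)

odd-2* : ∀ k → odd (2 * k) ≡ false
odd-2* zero    = refl
odd-2* (suc k) = trans (cong odd (*-suc 2 k)) (trans (not-involutive (odd (2 * k))) (odd-2* k))

¬odd⇒even : ∀ n → odd n ≡ false → ∃ λ k → n ≡ 2 * k
¬odd⇒even zero          _ = 0 , refl
¬odd⇒even (suc (suc n)) e with ¬odd⇒even n (trans (sym (not-involutive (odd n))) e)
... | k , refl = suc k , sym (*-suc 2 k)

hat : ∀ {n} → V n → V (suc n)
hat v = true ∷ v

hatSum : ∀ {n} → Subset n → V (suc n)
hatSum {n} X = ∑ (allV n) (λ v → X v · hat v)

hatSum-cong : ∀ {n} {X Y : Subset n} → (∀ v → X v ≡ Y v) → hatSum X ≡ hatSum Y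
hatSum-cong {n} X≗Y = ∑-cong (allV n) (λ v → cong (_· hat v) (X≗Y v))

hatSum≡odd∷Σ⊕ : ∀ {n} (X : Subset n) → hatSum X ≡ odd (card X) ∷ Σ⊕ X
hatSum≡odd∷Σ⊕ {n} X = go (allV n)
  where
  go : (l : List (V n)) →
       ∑ l (λ v → X v · hat v) ≡ odd (length (filterᵇ X l)) ∷ foldr _⊕_ 𝟘 (filterᵇ X l)
  go []      = refl
  go (v ∷ l) with X v
  ... | true  = cong (hat v ⊕_) (go l)
  ... | false = trans (⊕-identityˡ _) (go l)

InE⇔hatSum≡𝟘 : ∀ {n} (S X : Subset n) → InE S X ⇔ (X ⊆ S × hatSum X ≡ 𝟘)
InE⇔hatSum≡𝟘 S X = mk⇔
  (λ { (X⊆S , (k , ∣X∣≡2k) , ΣX≡𝟘) →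
         X⊆S , trans (hatSum≡odd∷Σ⊕ X) (cong₂ _∷_ (trans (cong odd ∣X∣≡2k) (odd-2* k)) ΣX≡𝟘) })
  (λ { (X⊆S , hatSumX≡𝟘) → let e = trans (sym (hatSum≡odd∷Σ⊕ X)) hatSumX≡𝟘 in
         X⊆S , ¬odd⇒even _ (cong head e) , cong tail e })

-- Affine automorphisms preserve E

homogenise : ∀ {n} → (V n → V n) → V n → V (suc n) → V (suc n)
homogenise L b (α ∷ y) = α ∷ (L y ⊕ α · b)

homogenise-additive : ∀ {n} {L : V n → V n} (b : V n) → Additive L → Additive (homogenise L b)
homogenise-additive {L = L} b L-add (α ∷ y) (β ∷ z) = cong ((α xor β) ∷_) (begin
  L (y ⊕ z) ⊕ (α xor β) · b          ≡⟨ cong₂ _⊕_ (L-add y z) (·-distribʳ α β b) ⟩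
  (L y ⊕ L z) ⊕ (α · b ⊕ β · b)      ≡⟨ ⊕-interchange (L y) (L z) (α · b) (β · b) ⟩
  (L y ⊕ α · b) ⊕ (L z ⊕ β · b)      ∎)
  where open ≡-Reasoning

homogenise-𝟘 : ∀ {n} {L : V n → V n} {b : V n} → Additive L → (∀ {x y} → L x ⊕ b ≡ L y ⊕ b → x ≡ y) →
               ∀ x → homogenise L b x ≡ 𝟘 → x ≡ 𝟘
homogenise-𝟘 {L = L} {b} L-add inj (false ∷ y) e =
  cong (false ∷_) (inj (cong (_⊕ b) (begin
    L y        ≡⟨ sym (⊕-identityʳ (L y)) ⟩
    L y ⊕ 𝟘    ≡⟨ cong tail e ⟩
    𝟘          ≡⟨ sym (additive-𝟘 L-add) ⟩
    L 𝟘        ∎)))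
  where open ≡-Reasoning

module AffineImage {n} {f : V n → V n} (L : V n → V n) (b : V n) (L-add : Additive L)
                   (f≡ : ∀ x → f x ≡ L x ⊕ b) (g : V n → V n)
                   (g∘f : ∀ x → g (f x) ≡ x) (f∘g : ∀ y → f (g y) ≡ y) where

  f̂ : V (suc n) → V (suc n)
  f̂ = homogenise L b

  hatSum-preimage : ∀ Y → hatSum Y ≡ f̂ (hatSum (Y ∘ f))
  hatSum-preimage Y = begin
    ∑ (allV n) (λ v → Y v · hat v)              ≡⟨ sym (∑-reindex f g g∘f f∘g _) ⟩
    ∑ (allV n) (λ u → Y (f u) · hat (f u))      ≡⟨ ∑-cong (allV n) (λ u → cong (λ v → Y (f u) · hat v) (f≡ u)) ⟩
    ∑ (allV n) (λ u → Y (f u) · f̂ (hat u))      ≡⟨ ∑-cong (allV n) (λ u → sym (additive-· f̂-add (Y (f u)) (hat u))) ⟩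
    ∑ (allV n) (λ u → f̂ (Y (f u) · hat u))      ≡⟨ sym (additive-∑ f̂-add (allV n) _) ⟩
    f̂ (hatSum (Y ∘ f))                          ∎
    where
    open ≡-Reasoning
    f̂-add = homogenise-additive b L-add

  hatSum-image : ∀ X → hatSum (X ∘ g) ≡ f̂ (hatSum X)
  hatSum-image X = trans (hatSum-preimage (X ∘ g)) (cong f̂ (hatSum-cong (λ v → cong X (g∘f v))))

  hatSum-preimage-𝟘 : ∀ Y → hatSum Y ≡ 𝟘 → hatSum (Y ∘ f) ≡ 𝟘
  hatSum-preimage-𝟘 Y e = homogenise-𝟘 L-add inj _ (trans (sym (hatSum-preimage Y)) e)
    where
    inj : ∀ {x y} → L x ⊕ b ≡ L y ⊕ b → x ≡ y
    inj {x} {y} e = trans (sym (g∘f x)) (trans (cong g (trans (f≡ x) (trans e (sym (f≡ y))))) (g∘f y))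

El-≡ : ∀ {n} {S : Subset n} {s t : El S} → proj₁ s ≡ proj₁ t → s ≡ t
El-≡ {s = x , p} {t = .x , q} refl = cong (x ,_) (Bool-UIP p q)

affine⇒EIso : ∀ {n} (S T : Subset n) → AffEquiv S T → Σ (El S ⤖ El T) (IsEIso S T)
affine⇒EIso {n} S T (f , (L , b , (L-add , _) , f≡ , (f-inj , f-surj)) , f[S]≡T) =
  mk⤖ (G-inj , G-surj) , image , preimage
  where
  g : V n → V n
  g y = proj₁ (f-surj y)
  f∘g : ∀ y → f (g y) ≡ y
  f∘g y = proj₂ (f-surj y) refl
  g∘f : ∀ x → g (f x) ≡ x
  g∘f x = f-inj (f∘g (f x))
  open AffineImage L b L-add f≡ g g∘f f∘g

  f∈T : ∀ {x} → S x ≡ true → T (f x) ≡ true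
  f∈T {x} x∈S = proj₂ (f[S]≡T (f x)) (x , x∈S , refl)

  G : El S → El T
  G (x , x∈S) = f x , f∈T x∈S
  G-inj : ∀ {s t} → G s ≡ G t → s ≡ t
  G-inj e = El-≡ (f-inj (cong proj₁ e))
  G-surj : ∀ t → ∃ λ s → ∀ {z} → z ≡ s → G z ≡ t
  G-surj (y , y∈T) with proj₁ (f[S]≡T y) y∈T
  ... | x , x∈S , fx≡y = (x , x∈S) , λ { refl → El-≡ fx≡y }

  image : ∀ X → InE S X → Σ (Subset n) λ Y → InE T Y × IsImage G X Y
  image X X∈E with Equivalence.to (InE⇔hatSum≡𝟘 S X) X∈E
  ... | X⊆S , hatSumX≡𝟘 =
    X ∘ g , Equivalence.from (InE⇔hatSum≡𝟘 T (X ∘ g)) (Y⊆T , hatSumY≡𝟘) , X⊆S , Y⊆T , λ s → cong X (sym (g∘f (proj₁ s)))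
    where
    Y⊆T : (X ∘ g) ⊆ T
    Y⊆T v gv∈X = subst (λ w → T w ≡ true) (f∘g v) (f∈T (X⊆S (g v) gv∈X))
    hatSumY≡𝟘 : hatSum (X ∘ g) ≡ 𝟘
    hatSumY≡𝟘 = trans (hatSum-image X) (trans (cong f̂ hatSumX≡𝟘) (additive-𝟘 (homogenise-additive b L-add)))

  preimage : ∀ Y → InE T Y → Σ (Subset n) λ X → InE S X × IsImage G X Y
  preimage Y Y∈E with Equivalence.to (InE⇔hatSum≡𝟘 T Y) Y∈E
  ... | Y⊆T , hatSumY≡𝟘 =
    Y ∘ f , Equivalence.from (InE⇔hatSum≡𝟘 S (Y ∘ f)) (X⊆S , hatSum-preimage-𝟘 Y hatSumY≡𝟘) , X⊆S , Y⊆T , λ _ → refl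
    where
    X⊆S : (Y ∘ f) ⊆ S
    X⊆S v fv∈Y with proj₁ (f[S]≡T (f v)) (Y⊆T (f v) fv∈Y)
    ... | x , x∈S , fx≡fv = subst (λ w → S w ≡ true) (f-inj fx≡fv) x∈S

-- Linear relations among families of vectors

lincomb : ∀ {m n} → V m → (Fin m → V n) → V n
lincomb []      a = 𝟘
lincomb (γ ∷ c) a = γ · a zero ⊕ lincomb c (a ∘ suc)

lincomb-cong : ∀ {m n} (c : V m) {a b : Fin m → V n} → (∀ i → a i ≡ b i) → lincomb c a ≡ lincomb c b
lincomb-cong []      e = refl
lincomb-cong (γ ∷ c) e = cong₂ _⊕_ (cong (γ ·_) (e zero)) (lincomb-cong c (e ∘ suc))

lincomb-𝟘ʳ : ∀ {m n} (c : V m) → lincomb {n = n} c (λ _ → 𝟘) ≡ 𝟘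
lincomb-𝟘ʳ []      = refl
lincomb-𝟘ʳ (γ ∷ c) = trans (cong₂ _⊕_ (·-𝟘 γ) (lincomb-𝟘ʳ c)) (⊕-identityˡ 𝟘)

lincomb-⊕ʳ : ∀ {m n} (c : V m) (a b : Fin m → V n) →
             lincomb c (λ i → a i ⊕ b i) ≡ lincomb c a ⊕ lincomb c b
lincomb-⊕ʳ []      a b = sym (⊕-identityˡ 𝟘)
lincomb-⊕ʳ (γ ∷ c) a b = trans (cong₂ _⊕_ (·-distribˡ γ (a zero) (b zero)) (lincomb-⊕ʳ c _ _))
                              (⊕-interchange _ _ _ _)

lincomb-𝟘ˡ : ∀ {m n} (a : Fin m → V n) → lincomb 𝟘 a ≡ 𝟘
lincomb-𝟘ˡ {zero}  a = refl
lincomb-𝟘ˡ {suc m} a = trans (⊕-identityˡ _) (lincomb-𝟘ˡ (a ∘ suc))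

lincomb-⊕ˡ : ∀ {m n} (c d : V m) (a : Fin m → V n) → lincomb (c ⊕ d) a ≡ lincomb c a ⊕ lincomb d a
lincomb-⊕ˡ []      []      a = sym (⊕-identityˡ 𝟘)
lincomb-⊕ˡ (γ ∷ c) (κ ∷ d) a = trans (cong₂ _⊕_ (·-distribʳ γ κ (a zero)) (lincomb-⊕ˡ c d _))
                                    (⊕-interchange _ _ _ _)

lincomb-·ˡ : ∀ {m n} (γ : Bool) (c : V m) (a : Fin m → V n) → lincomb (γ · c) a ≡ γ · lincomb c a
lincomb-·ˡ true  c a = refl
lincomb-·ˡ false c a = lincomb-𝟘ˡ a

additive-lincomb : ∀ {m n p} {f : V n → V p} → Additive f →
                   (c : V m) (a : Fin m → V n) → f (lincomb c a) ≡ lincomb c (f ∘ a)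
additive-lincomb f-add []      a = additive-𝟘 f-add
additive-lincomb f-add (γ ∷ c) a =
  trans (f-add _ _) (cong₂ _⊕_ (additive-· f-add γ (a zero)) (additive-lincomb f-add c (a ∘ suc)))

unit : ∀ {m} → Fin m → V m
unit zero    = true ∷ 𝟘
unit (suc i) = false ∷ unit i

lincomb-unit : ∀ {m n} (i : Fin m) (a : Fin m → V n) → lincomb (unit i) a ≡ a i
lincomb-unit zero    a = trans (cong (a zero ⊕_) (lincomb-𝟘ˡ (a ∘ suc))) (⊕-identityʳ _)
lincomb-unit (suc i) a = trans (⊕-identityˡ _) (lincomb-unit i (a ∘ suc))

-- Scalars are identified with vectors of F₂¹, so that _≼_ and lincomb apply to scalar families.
[_] : Bool → V 1
[ α ] = α ∷ []

[head] : ∀ {n} → V (suc n) → V 1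
[head] x = [ head x ]

[head]-additive : ∀ {n} → Additive ([head] {n})
[head]-additive (α ∷ x) (β ∷ y) = refl

head-⊕ : ∀ {n} (x y : V (suc n)) → head (x ⊕ y) ≡ head x xor head y
head-⊕ (α ∷ x) (β ∷ y) = refl

tail-additive : ∀ {n} → Additive (tail {n = n})
tail-additive (α ∷ x) (β ∷ y) = refl

∷-η : ∀ {n} (x : V (suc n)) → x ≡ head x ∷ tail x
∷-η (α ∷ x) = refl

lincombᵇ : ∀ {m} → V m → (Fin m → Bool) → Bool
lincombᵇ c β = head (lincomb c ([_] ∘ β))

lincomb-scalars : ∀ {m n} (c : V m) (β : Fin m → Bool) (w : V n) →
                  lincomb c (λ i → β i · w) ≡ lincombᵇ c β · w
lincomb-scalars c β w = sym (additive-lincomb ·w-additive c ([_] ∘ β))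
  where
  ·w-additive : Additive (λ (x : V 1) → head x · w)
  ·w-additive (α ∷ []) (β ∷ []) = ·-distribʳ α β w

lincomb-∷ : ∀ {m n} (c : V m) (β : Fin m → Bool) (a : Fin m → V n) →
            lincomb c (λ i → β i ∷ a i) ≡ lincombᵇ c β ∷ lincomb c a
lincomb-∷ c β a = begin
  lincomb c (λ i → β i ∷ a i)
    ≡⟨ ∷-η _ ⟩
  head (lincomb c (λ i → β i ∷ a i)) ∷ tail (lincomb c (λ i → β i ∷ a i))
    ≡⟨ cong₂ (λ x y → head x ∷ y) (additive-lincomb {f = [head]} [head]-additive c _)
                                   (additive-lincomb {f = tail} tail-additive c _) ⟩
  lincombᵇ c β ∷ lincomb c a
    ∎
  where open ≡-Reasoning

lincomb-shear : ∀ {m n} (c : V m) (a : Fin m → V n) (α : Fin m → Bool) (p : Fin m) →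
                lincomb c (λ i → a i ⊕ α i · a p) ≡ lincomb (c ⊕ lincombᵇ c α · unit p) a
lincomb-shear c a α p = begin
  lincomb c (λ i → a i ⊕ α i · a p)                 ≡⟨ lincomb-⊕ʳ c a _ ⟩
  lincomb c a ⊕ lincomb c (λ i → α i · a p)         ≡⟨ cong (lincomb c a ⊕_) (lincomb-scalars c α (a p)) ⟩
  lincomb c a ⊕ γ · a p                             ≡⟨ cong (λ x → lincomb c a ⊕ γ · x) (sym (lincomb-unit p a)) ⟩
  lincomb c a ⊕ γ · lincomb (unit p) a              ≡⟨ cong (lincomb c a ⊕_) (sym (lincomb-·ˡ γ (unit p) a)) ⟩
  lincomb c a ⊕ lincomb (γ · unit p) a              ≡⟨ sym (lincomb-⊕ˡ c _ a) ⟩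
  lincomb (c ⊕ γ · unit p) a                        ∎
  where
  open ≡-Reasoning
  γ = lincombᵇ c α

infix 4 _≼_
_≼_ : ∀ {m n p} → (Fin m → V n) → (Fin m → V p) → Set
a ≼ b = ∀ c → lincomb c a ≡ 𝟘 → lincomb c b ≡ 𝟘

≼-trans : ∀ {m n p q} {a : Fin m → V n} {b : Fin m → V p} {d : Fin m → V q} → a ≼ b → b ≼ d → a ≼ d
≼-trans a≼b b≼d c = b≼d c ∘ a≼b c

≼-cong : ∀ {m n p} {a a′ : Fin m → V n} {b b′ : Fin m → V p} →
         (∀ i → a i ≡ a′ i) → (∀ i → b i ≡ b′ i) → a ≼ b → a′ ≼ b′
≼-cong a≗a′ b≗b′ a≼b c e = trans (sym (lincomb-cong c b≗b′)) (a≼b c (trans (lincomb-cong c a≗a′) e))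

≼-mapʳ : ∀ {m n p q} {a : Fin m → V n} {b : Fin m → V p} {f : V p → V q} →
         Additive f → a ≼ b → a ≼ (f ∘ b)
≼-mapʳ {b = b} {f} f-add a≼b c e =
  trans (sym (additive-lincomb f-add c b)) (trans (cong f (a≼b c e)) (additive-𝟘 f-add))

≼-mapˡ : ∀ {m n p} {a : Fin m → V n} {f : V n → V p} →
         Additive f → (∀ x → f x ≡ 𝟘 → x ≡ 𝟘) → (f ∘ a) ≼ a
≼-mapˡ {a = a} {f} f-add f-ker c e = f-ker (lincomb c a) (trans (additive-lincomb f-add c a) e)

≼-at : ∀ {m n p} {a : Fin m → V n} {b : Fin m → V p} → a ≼ b → ∀ i → a i ≡ 𝟘 → b i ≡ 𝟘
≼-at {a = a} {b} a≼b i e = trans (sym (lincomb-unit i b)) (a≼b (unit i) (trans (lincomb-unit i a) e))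

≼-shear : ∀ {m n p} {a : Fin m → V n} {b : Fin m → V p} (α : Fin m → Bool) (q : Fin m) → a ≼ b →
          (λ i → a i ⊕ α i · a q) ≼ (λ i → b i ⊕ α i · b q)
≼-shear {a = a} {b} α q a≼b c e =
  trans (lincomb-shear c b α q) (a≼b (c ⊕ lincombᵇ c α · unit q) (trans (sym (lincomb-shear c a α q)) e))

≼-false∷ : ∀ {m n p} {a : Fin m → V n} {b : Fin m → V p} → (λ i → false ∷ a i) ≼ b → a ≼ b
≼-false∷ {a = a} a≼b c e =
  a≼b c (trans (lincomb-∷ c (λ _ → false) a) (cong₂ _∷_ (cong head (lincomb-𝟘ʳ {n = 1} c)) e))

-- Linear functionals with prescribed values

dot : ∀ {n} → V n → V n → V 1
dot []      x = 𝟘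
dot (ω ∷ w) x = [ ω ∧ head x ] ⊕ dot w (tail x)

dot-additive : ∀ {n} (w : V n) → Additive (dot w)
dot-additive []      x y = refl
dot-additive (ω ∷ w) (α ∷ x) (β ∷ y) =
  trans (cong₂ _⊕_ (cong [_] (∧-distribˡ-xor ω α β)) (dot-additive w x y)) (⊕-interchange _ _ _ _)

dot-𝟘ˡ : ∀ {n} (x : V n) → dot 𝟘 x ≡ 𝟘
dot-𝟘ˡ {zero}  x = refl
dot-𝟘ˡ {suc n} x = trans (⊕-identityˡ _) (dot-𝟘ˡ (tail x))

[∧]≡· : ∀ (ω α : Bool) → [ ω ∧ α ] ≡ α · [ ω ]
[∧]≡· ω true  = cong [_] (∧-identityʳ ω)
[∧]≡· ω false = cong [_] (∧-zeroʳ ω)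

[head]-V1 : (x : V 1) → [ head x ] ≡ x
[head]-V1 (α ∷ []) = refl

V0≡𝟘 : (x : V 0) → x ≡ 𝟘
V0≡𝟘 [] = refl

≼-tail : ∀ {m n p} {a : Fin m → V (suc n)} {b : Fin m → V p} →
         (∀ i → head (a i) ≡ false) → a ≼ b → (tail ∘ a) ≼ b
≼-tail {a = a} heads≡false a≼b =
  ≼-false∷ (≼-cong (λ i → trans (∷-η (a i)) (cong (_∷ tail (a i)) (heads≡false i))) (λ _ → refl) a≼b)

-- The elimination step of Gaussian elimination on the first coordinate.
head-eliminate : ∀ {n} (x y : V (suc n)) → head y ≡ true → head (x ⊕ head x · y) ≡ false
head-eliminate (true  ∷ x) (true ∷ y) refl = refl
head-eliminate (false ∷ x) (true ∷ y) refl = refl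

functional-extension : ∀ n {m} (a : Fin m → V n) (β : Fin m → V 1) → a ≼ β →
                       ∃ λ w → ∀ i → dot w (a i) ≡ β i
functional-extension zero    a β a≼β = [] , λ i → sym (≼-at a≼β i (V0≡𝟘 (a i)))
functional-extension (suc n) {m} a β a≼β with any? (λ i → head (a i) Bool.≟ true)
... | no ∄pivot = false ∷ proj₁ IH , λ i → trans (⊕-identityˡ _) (proj₂ IH i)
  where
  heads≡false : ∀ i → head (a i) ≡ false
  heads≡false i = ¬-not (λ e → ∄pivot (i , e))
  IH = functional-extension n (tail ∘ a) β (≼-tail heads≡false a≼β)
... | yes (q , pivot) = ω ∷ w , w-spec
  where
  α : Fin m → Bool
  α = head ∘ a
  a′ : Fin m → V (suc n)
  a′ i = a i ⊕ α i · a q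
  β′ : Fin m → V 1
  β′ i = β i ⊕ α i · β q
  IH = functional-extension n (tail ∘ a′) β′
         (≼-tail (λ i → head-eliminate (a i) (a q) pivot) (≼-shear α q a≼β))
  w = proj₁ IH
  d = dot w (tail (a q))
  -- chosen so that the pivot row a q itself is sent to β q
  ω = head (β q ⊕ d)
  w-spec : ∀ i → dot (ω ∷ w) (a i) ≡ β i
  w-spec i = begin
    [ ω ∧ α i ] ⊕ dot w (tail (a i))                  ≡⟨ cong (_⊕ dot w (tail (a i))) ([∧]≡· ω (α i)) ⟩
    α i · [ ω ] ⊕ dot w (tail (a i))                  ≡⟨ cong (λ x → α i · x ⊕ dot w (tail (a i))) ([head]-V1 (β q ⊕ d)) ⟩
    α i · (β q ⊕ d) ⊕ dot w (tail (a i))              ≡⟨ cong (_⊕ dot w (tail (a i))) (·-distribˡ (α i) (β q) d) ⟩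
    (α i · β q ⊕ α i · d) ⊕ dot w (tail (a i))        ≡⟨ ⊕-assoc-comm (α i · β q) (α i · d) _ ⟩
    α i · β q ⊕ (dot w (tail (a i)) ⊕ α i · d)        ≡⟨ cong (α i · β q ⊕_) (sym tail-a′) ⟩
    α i · β q ⊕ dot w (tail (a′ i))                   ≡⟨ cong (α i · β q ⊕_) (proj₂ IH i) ⟩
    α i · β q ⊕ (β i ⊕ α i · β q)                     ≡⟨ ⊕-cancelˡ (α i · β q) (β i) ⟩
    β i                                               ∎
    where
    open ≡-Reasoning
    tail-a′ : dot w (tail (a′ i)) ≡ dot w (tail (a i)) ⊕ α i · d
    tail-a′ = begin
      dot w (tail (a i ⊕ α i · a q))                  ≡⟨ cong (dot w) (tail-additive (a i) _) ⟩
      dot w (tail (a i) ⊕ tail (α i · a q))           ≡⟨ dot-additive w _ _ ⟩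
      dot w (tail (a i)) ⊕ dot w (tail (α i · a q))   ≡⟨ cong (dot w (tail (a i)) ⊕_)
                                                           (additive-· (additive-∘ (dot-additive w) tail-additive) (α i) (a q)) ⟩
      dot w (tail (a i)) ⊕ α i · d                    ∎

-- Linear automorphisms with prescribed values

record LinAut (n : ℕ) : Set where
  field
    to          : V n → V n
    from        : V n → V n
    to-additive : Additive to
    from∘to     : ∀ x → from (to x) ≡ x
    to∘from     : ∀ y → to (from y) ≡ y

  to-injective : ∀ {x y} → to x ≡ to y → x ≡ y
  to-injective {x} {y} e = trans (sym (from∘to x)) (trans (cong from e) (from∘to y))

  to-kernel : ∀ x → to x ≡ 𝟘 → x ≡ 𝟘
  to-kernel x e = to-injective (trans e (sym (additive-𝟘 to-additive)))

  from-additive : Additive from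
  from-additive x y = to-injective (begin
    to (from (x ⊕ y))            ≡⟨ to∘from (x ⊕ y) ⟩
    x ⊕ y                        ≡⟨ sym (cong₂ _⊕_ (to∘from x) (to∘from y)) ⟩
    to (from x) ⊕ to (from y)    ≡⟨ sym (to-additive (from x) (from y)) ⟩
    to (from x ⊕ from y)         ∎)
    where open ≡-Reasoning

open LinAut

idᴬ : ∀ {n} → LinAut n
idᴬ = record { to = λ x → x ; from = λ x → x ; to-additive = λ _ _ → refl
             ; from∘to = λ _ → refl ; to∘from = λ _ → refl }

infixr 9 _∘ᴬ_
_∘ᴬ_ : ∀ {n} → LinAut n → LinAut n → LinAut n
M ∘ᴬ N = record
  { to          = to M ∘ to N
  ; from        = from N ∘ from M
  ; to-additive = additive-∘ (to-additive M) (to-additive N)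
  ; from∘to     = λ x → trans (cong (from N) (from∘to M (to N x))) (from∘to N x)
  ; to∘from     = λ y → trans (cong (to M) (to∘from N (from M y))) (to∘from M y) }

infix 10 _⁻¹ᴬ
_⁻¹ᴬ : ∀ {n} → LinAut n → LinAut n
M ⁻¹ᴬ = record { to = from M ; from = to M ; to-additive = from-additive M
               ; from∘to = to∘from M ; to∘from = from∘to M }

≼-aut : ∀ {m n} (R R′ : LinAut n) {a b : Fin m → V n} → a ≼ b → (to R ∘ a) ≼ (to R′ ∘ b)
≼-aut R R′ a≼b = ≼-trans (≼-mapˡ (to-additive R) (to-kernel R)) (≼-mapʳ (to-additive R′) a≼b)

involution : ∀ {n} (f : V n → V n) → Additive f → (∀ x → f (f x) ≡ x) → LinAut n
involution f f-add f∘f = record { to = f ; from = f ; to-additive = f-add ; from∘to = f∘f ; to∘from = f∘f }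

transvection : ∀ {n} → V n → LinAut (suc n)
transvection r = involution t t-additive t∘t
  where
  t : V (suc _) → V (suc _)
  t (α ∷ y) = α ∷ (y ⊕ α · r)
  t-additive : Additive t
  t-additive (α ∷ y) (β ∷ z) =
    cong ((α xor β) ∷_) (trans (cong ((y ⊕ z) ⊕_) (·-distribʳ α β r)) (⊕-interchange y z (α · r) (β · r)))
  t∘t : ∀ x → t (t x) ≡ x
  t∘t (α ∷ y) = cong (α ∷_) (⊕-cancelʳ y (α · r))

swap₀₁ : ∀ {n} → LinAut (suc (suc n))
swap₀₁ = involution s (λ { (α ∷ β ∷ x) (γ ∷ κ ∷ y) → refl }) (λ { (α ∷ β ∷ x) → refl })
  where
  s : V (suc (suc _)) → V (suc (suc _))
  s (α ∷ β ∷ x) = β ∷ α ∷ x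

blockAut : ∀ {n} → LinAut n → V n → LinAut (suc n)
blockAut M w = record
  { to          = λ { (α ∷ y) → (α xor head (dot w y)) ∷ to M y }
  ; from        = λ { (β ∷ z) → (β xor head (dot w (from M z))) ∷ from M z }
  ; to-additive = λ { (α ∷ y) (β ∷ z) → cong₂ _∷_
       (trans (cong ((α xor β) xor_) (trans (cong head (dot-additive w y z)) (head-⊕ (dot w y) (dot w z))))
              (xor-interchange α β (head (dot w y)) (head (dot w z))))
       (to-additive M y z) }
  ; from∘to     = λ { (α ∷ y) → cong₂ _∷_
       (trans (cong (λ u → (α xor head (dot w y)) xor head (dot w u)) (from∘to M y)) (xor-cancelʳ α _))
       (from∘to M y) }
  ; to∘from     = λ { (β ∷ z) → cong₂ _∷_ (xor-cancelʳ β _) (to∘from M z) } }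

blockAut-maps : ∀ {n} (M : LinAut n) (w : V n) (x y : V (suc n)) →
                to M (tail x) ≡ tail y → dot w (tail x) ≡ [ head y xor head x ] → to (blockAut M w) x ≡ y
blockAut-maps M w (α ∷ x) (β ∷ y) Mx≡y wx≡β+α =
  cong₂ _∷_ (trans (cong (λ d → α xor head d) wx≡β+α) (trans (cong (α xor_) (xor-comm β α)) (xor-cancelˡ α β)))
            Mx≡y

e₀ : ∀ {n} → V (suc n)
e₀ = true ∷ 𝟘

normalise : ∀ {n} (v : V (suc n)) → v ≢ 𝟘 → Σ (LinAut (suc n)) λ P → to P v ≡ e₀
normalise (true ∷ r) _ = transvection r , cong (true ∷_) (⊕-self r)
normalise {zero} (false ∷ []) v≢𝟘 = ⊥-elim (v≢𝟘 refl)
normalise {suc n} (false ∷ r) v≢𝟘 with normalise r (v≢𝟘 ∘ cong (false ∷_))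
... | P , Pr≡e₀ = swap₀₁ ∘ᴬ blockAut P 𝟘 ,
                  cong (to swap₀₁) (cong₂ _∷_ (cong head (dot-𝟘ˡ r)) Pr≡e₀)

⊕-·e₀ : ∀ {n} (x : V (suc n)) (γ : Bool) → x ⊕ γ · e₀ ≡ (head x xor γ) ∷ tail x
⊕-·e₀ (α ∷ x) true  = cong ((α xor true) ∷_) (⊕-identityʳ x)
⊕-·e₀ (α ∷ x) false = cong ((α xor false) ∷_) (⊕-identityʳ x)

≼-pivot : ∀ {m n} {a b : Fin m → V (suc n)} (q : Fin m) → a q ≡ e₀ → b q ≡ e₀ → a ≼ b →
          (tail ∘ a) ≼ (λ i → (head (b i) xor head (a i)) ∷ tail (b i))
≼-pivot {a = a} {b} q aq≡e₀ bq≡e₀ a≼b = ≼-false∷ (≼-cong cleared sheared (≼-shear (head ∘ a) q a≼b))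
  where
  cleared : ∀ i → a i ⊕ head (a i) · a q ≡ false ∷ tail (a i)
  cleared i = trans (cong (λ v → a i ⊕ head (a i) · v) aq≡e₀)
                    (trans (⊕-·e₀ (a i) _) (cong (_∷ tail (a i)) (xor-same (head (a i)))))
  sheared : ∀ i → b i ⊕ head (a i) · b q ≡ (head (b i) xor head (a i)) ∷ tail (b i)
  sheared i = trans (cong (λ v → b i ⊕ head (a i) · v) bq≡e₀) (⊕-·e₀ (b i) _)

-- Induction on the dimension: move a nonzero a q and its partner b q to e₀, extend on the
-- remaining coordinates, and repair the first coordinate with a linear functional.
automorphism-extension : ∀ n {m} (a b : Fin m → V n) → a ≼ b → b ≼ a →
                         Σ (LinAut n) λ M → ∀ i → to M (a i) ≡ b i
automorphism-extension zero    a b _ _ = idᴬ , λ i → trans (V0≡𝟘 (a i)) (sym (V0≡𝟘 (b i)))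
automorphism-extension (suc n) {m} a b a≼b b≼a with all? (λ i → a i ≟ 𝟘)
... | yes a≡𝟘 = idᴬ , λ i → trans (a≡𝟘 i) (sym (≼-at a≼b i (a≡𝟘 i)))
... | no  a≢𝟘 = Q ⁻¹ᴬ ∘ᴬ (blockAut M w ∘ᴬ P) , maps
  where
  q = proj₁ (¬∀⟶∃¬ m _ (λ i → a i ≟ 𝟘) a≢𝟘)
  aq≢𝟘 : a q ≢ 𝟘
  aq≢𝟘 = proj₂ (¬∀⟶∃¬ m _ (λ i → a i ≟ 𝟘) a≢𝟘)
  P = proj₁ (normalise (a q) aq≢𝟘)
  Q = proj₁ (normalise (b q) (aq≢𝟘 ∘ ≼-at b≼a q))
  Paq≡e₀ = proj₂ (normalise (a q) aq≢𝟘)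
  Qbq≡e₀ = proj₂ (normalise (b q) (aq≢𝟘 ∘ ≼-at b≼a q))
  a* = to P ∘ a
  b* = to Q ∘ b
  a*≼pivot = ≼-pivot q Paq≡e₀ Qbq≡e₀ (≼-aut P Q a≼b)
  b*≼pivot = ≼-pivot q Qbq≡e₀ Paq≡e₀ (≼-aut Q P b≼a)
  IH = automorphism-extension n (tail ∘ a*) (tail ∘ b*)
         (≼-mapʳ {f = tail} tail-additive a*≼pivot) (≼-mapʳ {f = tail} tail-additive b*≼pivot)
  M = proj₁ IH
  L = functional-extension n (tail ∘ a*) (λ i → [ head (b* i) xor head (a* i) ])
        (≼-mapʳ {f = [head]} [head]-additive a*≼pivot)
  w = proj₁ L
  maps : ∀ i → from Q (to (blockAut M w) (to P (a i))) ≡ b i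
  maps i = trans (cong (from Q) (blockAut-maps M w (a* i) (b* i) (proj₂ IH i) (proj₂ L i))) (from∘to Q (b i))

≼-differences : ∀ {m n p} {a : Fin m → V n} {b : Fin m → V p} (q : Fin m) → (hat ∘ a) ≼ (hat ∘ b) →
                (λ i → a i ⊕ a q) ≼ (λ i → b i ⊕ b q)
≼-differences q â≼b̂ = ≼-false∷ (≼-mapʳ tail-additive (≼-shear (λ _ → true) q â≼b̂))

id-affine : ∀ {n} → IsAffineAut {n} (λ x → x)
id-affine = (λ x → x) , 𝟘 , ((λ _ _ → refl) , (λ _ _ → refl)) , (λ x → sym (⊕-identityʳ x)) ,
            (λ e → e) , (λ y → y , λ e → e)

affine-extension : ∀ {m n} (a b : Fin m → V n) → (hat ∘ a) ≼ (hat ∘ b) → (hat ∘ b) ≼ (hat ∘ a) →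
                   Σ (V n → V n) λ f → IsAffineAut f × (∀ i → f (a i) ≡ b i)
affine-extension {zero}      a b _   _   = (λ x → x) , id-affine , λ ()
affine-extension {suc m} {n} a b â≼b̂ b̂≼â =
  f , (to M , t , (to-additive M , additive-· (to-additive M)) , (λ _ → refl) , f-inj , f-surj) , f-maps
  where
  q : Fin (suc m)
  q = zero
  E = automorphism-extension n _ _ (≼-differences q â≼b̂) (≼-differences q b̂≼â)
  M = proj₁ E
  t = to M (a q) ⊕ b q
  f : V n → V n
  f x = to M x ⊕ t
  f-inj : ∀ {x y} → f x ≡ f y → x ≡ y
  f-inj e = to-injective M (⊕-injectiveʳ t e)
  f-surj : ∀ y → ∃ λ x → ∀ {z} → z ≡ x → f z ≡ y
  f-surj y = from M (y ⊕ t) , λ { refl → trans (cong (_⊕ t) (to∘from M (y ⊕ t))) (⊕-cancelʳ y t) }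
  f-maps : ∀ i → f (a i) ≡ b i
  f-maps i = begin
    to M (a i) ⊕ (to M (a q) ⊕ b q)     ≡⟨ sym (⊕-assoc _ _ _) ⟩
    (to M (a i) ⊕ to M (a q)) ⊕ b q     ≡⟨ cong (_⊕ b q) (sym (to-additive M (a i) (a q))) ⟩
    to M (a i ⊕ a q) ⊕ b q              ≡⟨ cong (_⊕ b q) (proj₂ E i) ⟩
    (b i ⊕ b q) ⊕ b q                   ≡⟨ ⊕-cancelʳ (b i) (b q) ⟩
    b i                                 ∎
    where open ≡-Reasoning

-- From an E-isomorphism to an affine automorphism

∈-allV : ∀ {n} (v : V n) → v ∈ allV n
∈-allV []          = here refl
∈-allV (false ∷ v) = ∈-++⁺ˡ (∈-map⁺ (false ∷_) (∈-allV v))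
∈-allV (true ∷ v)  = ∈-++⁺ʳ (map (false ∷_) (allV _)) (∈-map⁺ (true ∷_) (∈-allV v))

enumerate : ∀ {n} (S : Subset n) → Fin (card S) → El S
enumerate {n} S i = lookup (elems S) i , T⇒≡true (proj₂ (∈-filter⁻ (T? ∘ S) {xs = allV n} (∈-lookup i)))
  where
  T⇒≡true : ∀ {b} → T b → b ≡ true
  T⇒≡true = Equivalence.to T-≡

enumerate-onto : ∀ {n} (S : Subset n) (s : El S) → ∃ λ i → enumerate S i ≡ s
enumerate-onto S (x , x∈S) = index x∈elems , El-≡ (sym (lookup-index x∈elems))
  where
  x∈elems = ∈-filter⁺ (T? ∘ S) (∈-allV x) (Equivalence.from T-≡ x∈S)

support : ∀ {m n} → V m → (Fin m → V n) → Subset n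
support c a v = lincombᵇ c (λ i → δ (a i) v)

∑-lincomb : ∀ {A : Set} {m n} (l : List A) (c : V m) (F : Fin m → A → V n) →
            ∑ l (λ v → lincomb c (λ i → F i v)) ≡ lincomb c (λ i → ∑ l (F i))
∑-lincomb []      c F = sym (lincomb-𝟘ʳ c)
∑-lincomb (v ∷ l) c F = trans (cong (_ ⊕_) (∑-lincomb l c F)) (sym (lincomb-⊕ʳ c _ _))

hatSum-support : ∀ {m n} (c : V m) (a : Fin m → V n) → hatSum (support c a) ≡ lincomb c (hat ∘ a)
hatSum-support {n = n} c a = begin
  ∑ (allV n) (λ v → support c a v · hat v)                  ≡⟨ ∑-cong (allV n) (λ v → sym (lincomb-scalars c _ (hat v))) ⟩
  ∑ (allV n) (λ v → lincomb c (λ i → δ (a i) v · hat v))    ≡⟨ ∑-lincomb (allV n) c _ ⟩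
  lincomb c (λ i → ∑ (allV n) (λ v → δ (a i) v · hat v))    ≡⟨ lincomb-cong c (λ i → ∑-δ (a i) hat) ⟩
  lincomb c (hat ∘ a)                                       ∎
  where open ≡-Reasoning

support-outside : ∀ {m n} {S : Subset n} (c : V m) (a : Fin m → V n) → (∀ i → S (a i) ≡ true) →
                  ∀ v → S v ≡ false → support c a v ≡ false
support-outside {S = S} c a a∈S v v∉S =
  cong head (trans (lincomb-cong c (λ i → cong [_] (dec-false (a i ≟ v) (ai≢v i)))) (lincomb-𝟘ʳ c))
  where
  ai≢v : ∀ i → a i ≢ v
  ai≢v i refl with trans (sym (a∈S i)) v∉S
  ... | ()

⊆-outside : ∀ {n} {X S : Subset n} → X ⊆ S → ∀ v → S v ≡ false → X v ≡ false
⊆-outside {X = X} X⊆S v v∉S with X v in Xv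
... | false = refl
... | true  = trans (sym (X⊆S v Xv)) v∉S

support⊆ : ∀ {m n} {S : Subset n} (c : V m) (a : Fin m → V n) → (∀ i → S (a i) ≡ true) → support c a ⊆ S
support⊆ {S = S} c a a∈S v v∈supp with S v in Sv
... | true  = refl
... | false = trans (sym (support-outside c a a∈S v Sv)) v∈supp

-- X coincides with support c a, since both vanish outside S.
support-unique : ∀ {m n} {S X : Subset n} (c : V m) (a : Fin m → V n) → (∀ i → S (a i) ≡ true) →
                 InE S X → (∀ (s : El S) → X (proj₁ s) ≡ support c a (proj₁ s)) → lincomb c (hat ∘ a) ≡ 𝟘
support-unique {S = S} {X} c a a∈S X∈E agree =
  trans (sym (hatSum-support c a)) (trans (hatSum-cong (λ v → sym (X≗supp v))) (proj₂ X∈E′))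
  where
  X∈E′ = Equivalence.to (InE⇔hatSum≡𝟘 S X) X∈E
  X≗supp : ∀ v → X v ≡ support c a v
  X≗supp v with S v in Sv
  ... | true  = agree (v , Sv)
  ... | false = trans (⊆-outside (proj₁ X∈E′) v Sv) (sym (support-outside c a a∈S v Sv))

support∈E : ∀ {m n} {S : Subset n} (c : V m) (a : Fin m → V n) → (∀ i → S (a i) ≡ true) →
            lincomb c (hat ∘ a) ≡ 𝟘 → InE S (support c a)
support∈E {S = S} c a a∈S e =
  Equivalence.from (InE⇔hatSum≡𝟘 S (support c a)) (support⊆ c a a∈S , trans (hatSum-support c a) e)

module Transfer {n} {S T : Subset n} (g : El S ⤖ El T) (iso : IsEIso S T g) {m} (pts : Fin m → El S) where

  private
    G = Bijection.to g

  a : Fin m → V n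
  a = proj₁ ∘ pts
  b : Fin m → V n
  b = proj₁ ∘ G ∘ pts

  support-transport : ∀ (c : V m) (s : El S) → support c a (proj₁ s) ≡ support c b (proj₁ (G s))
  support-transport c s = cong head (lincomb-cong c (λ i → cong [_] (δ-transport i)))
    where
    δ-transport : ∀ i → δ (a i) (proj₁ s) ≡ δ (b i) (proj₁ (G s))
    δ-transport i = does-⇔ (mk⇔ (λ e → cong (proj₁ ∘ G) (El-≡ e)) (λ e → cong proj₁ (Bijection.injective g (El-≡ e))))
                           (a i ≟ proj₁ s) (b i ≟ proj₁ (G s))

  hat-≼ : (hat ∘ a) ≼ (hat ∘ b)
  hat-≼ c c-rel with proj₁ iso (support c a) (support∈E c a (proj₂ ∘ pts) c-rel)
  ... | Y , Y∈E , _ , _ , image = support-unique c b (proj₂ ∘ G ∘ pts) Y∈E agree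
    where
    agree : ∀ (t : El T) → Y (proj₁ t) ≡ support c b (proj₁ t)
    agree t with Bijection.strictlySurjective g t
    ... | s , refl = trans (sym (image s)) (support-transport c s)

  hat-≽ : (hat ∘ b) ≼ (hat ∘ a)
  hat-≽ c c-rel with proj₂ iso (support c b) (support∈E c b (proj₂ ∘ G ∘ pts) c-rel)
  ... | X , X∈E , _ , _ , image = support-unique c a (proj₂ ∘ pts) X∈E
                                    (λ s → trans (image s) (sym (support-transport c s)))

image-of-enumeration : ∀ {n m} {S T : Subset n} (g : El S ⤖ El T) (pts : Fin m → El S) →
                       (∀ s → ∃ λ i → pts i ≡ s) → (f : V n → V n) →
                       (∀ i → f (proj₁ (pts i)) ≡ proj₁ (Bijection.to g (pts i))) →
                       ∀ y → (T y ≡ true → ∃ λ x → S x ≡ true × f x ≡ y) ×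
                             ((∃ λ x → S x ≡ true × f x ≡ y) → T y ≡ true)
image-of-enumeration {T = T} g pts onto f f-maps y = f⁻¹[T] , f[S]
  where
  f⁻¹[T] : T y ≡ true → ∃ λ x → _ × f x ≡ y
  f⁻¹[T] y∈T with Bijection.strictlySurjective g (y , y∈T)
  ... | s , Gs≡y with onto s
  ...   | i , refl = proj₁ (pts i) , proj₂ (pts i) , trans (f-maps i) (cong proj₁ Gs≡y)
  f[S] : (∃ λ x → _ × f x ≡ y) → T y ≡ true
  f[S] (x , x∈S , fx≡y) with onto (x , x∈S)
  ... | i , refl = subst (λ v → T v ≡ true) (trans (sym (f-maps i)) fx≡y) (proj₂ (Bijection.to g (pts i)))

EIso⇒affine : ∀ {n} (S T : Subset n) → Σ (El S ⤖ El T) (IsEIso S T) → AffEquiv S T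
EIso⇒affine S T (g , iso) = f , f-affine , image-of-enumeration g (enumerate S) (enumerate-onto S) f f-maps
  where
  open Transfer g iso (enumerate S)
  A = affine-extension a b hat-≼ hat-≽
  f = proj₁ A
  f-affine = proj₁ (proj₂ A)
  f-maps = proj₂ (proj₂ A)

theorem5p6 : (n : ℕ) (S T : Subset n) →
    AffEquiv S T ⇔ Σ (El S ⤖ El T) (λ g → IsEIso S T g)
theorem5p6 n S T = mk⇔ (affine⇒EIso S T) (EIso⇒affine S T)
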